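{- Let $R$ be an LM-system. Then $R\rightsquigarrow R=\emptyset$.
   Context: $R\rightsquigarrow R$ is the set of all rules $\sigma(l_1)\to\sigma(r_1[r_2]_p)$ where $l_1\to r_1$, $l_2\to r_2$ are rules of $R$, $p\in\mathcal{FP}os(r_1)$, $\sigma=\mathrm{mgu}(r_1|_p,l_2)$ exists, and the resulting rule is not redundant in $R$. Terms are first-order over a ranked signature and variables; $t(\epsilon)$ is the root symbol of $t$, $t(p)$ the symbol at position $p$, $t|_p$ the subterm at $p$, $t[u]_p$ replacement, $\mathcal{FP}os(t)$ the non-variable positions. A rewrite rule $l\to r$ has $\mathrm{Var}(r)\subseteq\mathrm{Var}(l)$; a TRS is a set of rules; convergent = confluent and terminating. The root pair of a rule or equation $l\to r$ (or $l\approx r$) is $(l(\epsilon),r(\epsilon))$. Redundancy: fix a reduction order $\prec$ total on ground terms, extended to equations via the multiset extension on $\{s,t\}$; an equation $e$ is redundant in $E$ iff every ground instance $\sigma(e)$ is an equational consequence of ground instances of equations of $E$ smaller than $\sigma(e)$. Forward closure: for rules $\rho_1:l_1\to r_1$, $\rho_2:l_2\to r_2$, $p\in\mathcal{FP}os(r_1)$ with $\sigma=\mathrm{mgu}(r_1|_p,l_2)$, $\rho_1\rightsquigarrow_p\rho_2=\sigma(l_1)\to\sigma(r_1[r_2]_p)$; $R_1\rightsquigarrow R_2$ is the set of these (with $\rho_i\in R_i$) not redundant in $R_1$; $FC_0(R)=R$, $FC_{k+1}(R)=FC_k(R)\cup(FC_k(R)\rightsquigarrow R)$, $FC(R)=\bigcup_k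 FC_k(R)$; $R$ is forward-closed iff $FC(R)=R$. RHS critical pairs: for rules $s\to t$, $u\to v$ of $R$ (variables renamed apart) with $\sigma=\mathrm{mgu}(t,v)$ and $s\sigma\neq u\sigma$, the equation $s\sigma\approx u\sigma$ is a right-hand-side critical pair. $RHS(R)$ is $R$ (as equations) together with all such equations. A set of equations $E$ is quasi-deterministic iff no equation has a variable as a side, no equation has the same root symbol on both sides, and no two distinct equations of $E$ have the same pair of root symbols on their sides. $R$ is non-subterm-collapsing iff there are no terms $t,u$ with $t$ a proper subterm of $u$ and $t=_R u$. $R$ is right-reduced iff for every rule $l\to r$, $r$ is in $R$-normal form. $R$ is almost-left-reduced iff there are no rules $l_1\to r_1$, $l_2\to r_2$ in $R$ and position $p\in\mathcal{FP}os(l_1)\setminus\{\epsilon\}$ with $l_1|_p$ an instance of $l_2$. An LM-system is a convergent, almost-left-reduced, right-reduced TRS $R$ that is non-subterm-collapsing, forward-closed, and such that $RHS(R)$ is quasi-deterministic. -}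

module Defs where

open import Data.Nat using (ℕ; zero; suc)
open import Data.List using (List; []; _∷_; _++_)
open import Data.List.Relation.Unary.All using (All)
open import Data.List.Relation.Unary.Any using (Any)
open import Data.List.Relation.Binary.Permutation.Propositional using (_↭_)
open import Data.Vec using (Vec; []; _∷_)
open import Data.Maybe using (Maybe; just; nothing)
open import Data.Product using (Σ; ∃; ∃-syntax; _×_; _,_)
open import Data.Sum using (_⊎_)
open import Relation.Nullary using (¬_)
open import Relation.Binary.PropositionalEquality using (_≡_; _≢_)
open import Relation.Binary.Construct.Closure.ReflexiveTransitive using (Star)
open import Relation.Binary.Construct.Closure.Equivalence using (EqClosure)
open import Induction.WellFounded using (WellFounded)

record Signature : Set₁ where
  field
    Fun   : Set
    arity : Fun → ℕ

module Terms (Sig : Signature) where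
  open Signature Sig

  -- Variables: a countably infinite set (needed for renaming apart).
  Var : Set
  Var = ℕ

  data Term : Set where
    var : Var → Term
    fun : (f : Fun) → Vec Term (arity f) → Term

  -- Positions: lists of (0-based) argument indices; [] is the root ε.
  Pos : Set
  Pos = List ℕ

  mutual
    subAt : Term → Pos → Maybe Term
    subAt t [] = just t
    subAt (var x) (i ∷ p) = nothing
    subAt (fun f ts) (i ∷ p) = subArgs ts i p

    subArgs : ∀ {n} → Vec Term n → ℕ → Pos → Maybe Term
    subArgs [] i p = nothing
    subArgs (t ∷ ts) zero p = subAt t p
    subArgs (t ∷ ts) (suc i) p = subArgs ts i p

  -- t[u]_p  (only used at positions of t)
  mutual
    replaceAt : Term → Pos → Term → Term
    replaceAt t [] u = u
    replaceAt (var x) (i ∷ p) u = var x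
    replaceAt (fun f ts) (i ∷ p) u = fun f (replaceArgs ts i p u)

    replaceArgs : ∀ {n} → Vec Term n → ℕ → Pos → Term → Vec Term n
    replaceArgs [] i p u = []
    replaceArgs (t ∷ ts) zero p u = replaceAt t p u ∷ ts
    replaceArgs (t ∷ ts) (suc i) p u = t ∷ replaceArgs ts i p u

  IsPos : Term → Pos → Set
  IsPos t p = ∃[ v ] (subAt t p ≡ just v)

  IsFPos : Term → Pos → Set
  IsFPos t p = ∃[ f ] ∃[ ts ] (subAt t p ≡ just (fun f ts))

  _∈V_ : Var → Term → Set
  x ∈V t = ∃[ p ] (subAt t p ≡ just (var x))

  Ground : Term → Set
  Ground t = ∀ x → ¬ (x ∈V t)

  IsVar : Term → Set
  IsVar t = ∃[ x ] (t ≡ var x)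

  HasRoot : Term → Fun → Set
  HasRoot t f = ∃[ ts ] (t ≡ fun f ts)

  Subst : Set
  Subst = Var → Term

  mutual
    _·_ : Subst → Term → Term
    σ · var x = σ x
    σ · fun f ts = fun f (σ ·* ts)

    _·*_ : ∀ {n} → Subst → Vec Term n → Vec Term n
    σ ·* [] = []
    σ ·* (t ∷ ts) = (σ · t) ∷ (σ ·* ts)

  IsMGU : Subst → Term → Term → Set
  IsMGU σ s t = (σ · s ≡ σ · t)
              × (∀ θ → θ · s ≡ θ · t → ∃[ δ ] (∀ x → θ x ≡ δ · σ x))

  -- Rules l → r and equations l ≈ r are both represented as pairs of terms.
  record Eqn : Set where
    constructor _⇒_
    field
      lhs : Term
      rhs : Term
  open Eqn public

  _·e_ : Subst → Eqn → Eqn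
  σ ·e (l ⇒ r) = (σ · l) ⇒ (σ · r)

  _∈Ve_ : Var → Eqn → Set
  x ∈Ve e = x ∈V lhs e ⊎ x ∈V rhs e

  GroundEqn : Eqn → Set
  GroundEqn e = Ground (lhs e) × Ground (rhs e)

  -- e and e' are variants (instances of each other, i.e. equal up to renaming)
  Variant : Eqn → Eqn → Set
  Variant e e' = (∃[ σ ] (σ ·e e ≡ e')) × (∃[ τ ] (τ ·e e' ≡ e))

  Disjoint : Eqn → Eqn → Set
  Disjoint e e' = ∀ x → x ∈Ve e → ¬ (x ∈Ve e')

  EqnSet : Set₁
  EqnSet = Eqn → Set

  Step : EqnSet → Term → Term → Set
  Step E s t = ∃[ e ] (E e × ∃[ σ ] ∃[ p ]
                 (subAt s p ≡ just (σ · lhs e) × t ≡ replaceAt s p (σ · rhs e)))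

  _≈[_]_ : Term → EqnSet → Term → Set
  s ≈[ E ] t = EqClosure (Step E) s t

  _⟶*[_]_ : Term → EqnSet → Term → Set
  s ⟶*[ R ] t = Star (Step R) s t

  IsTRS : EqnSet → Set
  IsTRS R = ∀ ρ → R ρ → ∀ x → x ∈V rhs ρ → x ∈V lhs ρ

  Terminating : EqnSet → Set
  Terminating R = WellFounded (λ t s → Step R s t)

  Confluent : EqnSet → Set
  Confluent R = ∀ {s t u} → s ⟶*[ R ] t → s ⟶*[ R ] u →
                ∃[ v ] (t ⟶*[ R ] v × u ⟶*[ R ] v)

  Convergent : EqnSet → Set
  Convergent R = Confluent R × Terminating R

  NormalForm : EqnSet → Term → Set
  NormalForm R t = ∀ u → ¬ Step R t u

  NonSubtermCollapsing : EqnSet → Set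
  NonSubtermCollapsing R =
    ∀ t u p → p ≢ [] → subAt u p ≡ just t → ¬ (t ≈[ R ] u)

  RightReduced : EqnSet → Set
  RightReduced R = ∀ ρ → R ρ → NormalForm R (rhs ρ)

  AlmostLeftReduced : EqnSet → Set
  AlmostLeftReduced R =
    ∀ ρ₁ ρ₂ → R ρ₁ → R ρ₂ → ∀ p → IsFPos (lhs ρ₁) p → p ≢ [] →
    ¬ (∃[ σ ] (subAt (lhs ρ₁) p ≡ just (σ · lhs ρ₂)))

  RHSCP : EqnSet → EqnSet
  RHSCP R e = ∃[ ρ₁ ] ∃[ ρ₂ ] ∃[ ρ₂' ] (R ρ₁ × R ρ₂ × Variant ρ₂ ρ₂' × Disjoint ρ₁ ρ₂'
              × ∃[ σ ] (IsMGU σ (rhs ρ₁) (rhs ρ₂') × σ · lhs ρ₁ ≢ σ · lhs ρ₂'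
                        × e ≡ ((σ · lhs ρ₁) ⇒ (σ · lhs ρ₂'))))

  RHS : EqnSet → EqnSet
  RHS R e = R e ⊎ RHSCP R e

  -- quasi-deterministic (distinctness of equations understood up to variants)
  QuasiDeterministic : EqnSet → Set
  QuasiDeterministic E =
      (∀ e → E e → ¬ IsVar (lhs e) × ¬ IsVar (rhs e))
    × (∀ e → E e → ∀ f g → HasRoot (lhs e) f → HasRoot (rhs e) g → f ≢ g)
    × (∀ e e' → E e → E e' → ∀ f g → HasRoot (lhs e) f → HasRoot (rhs e) g →
         HasRoot (lhs e') f → HasRoot (rhs e') g → Variant e e')

  -- reduction order, total on ground terms (s ≺ t : s smaller than t)
  record IsReductionOrder (_≺_ : Term → Term → Set) : Set where
    field
      irrefl      : ∀ t → ¬ (t ≺ t)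
      trans       : ∀ {s t u} → s ≺ t → t ≺ u → s ≺ u
      wf          : WellFounded _≺_
      monotonic   : ∀ {s t} u p → IsPos u p → s ≺ t → replaceAt u p s ≺ replaceAt u p t
      stable      : ∀ {s t} σ → s ≺ t → (σ · s) ≺ (σ · t)
      totalGround : ∀ {s t} → Ground s → Ground t → s ≡ t ⊎ (s ≺ t ⊎ t ≺ s)

  module Order (_≺_ : Term → Term → Set) where

    -- Dershowitz–Manna multiset extension (multisets as lists up to permutation)
    _≺mul_ : List Term → List Term → Set
    M ≺mul N = ∃[ Z ] ∃[ X ] ∃[ Y ] (M ↭ Z ++ X × N ↭ Z ++ Y × Y ≢ []
                                     × All (λ x → Any (x ≺_) Y) X)

    _≺e_ : Eqn → Eqn → Set
    e ≺e e' = (lhs e ∷ rhs e ∷ []) ≺mul (lhs e' ∷ rhs e' ∷ [])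

    SmallerGroundInstances : EqnSet → Eqn → EqnSet
    SmallerGroundInstances E e g =
      ∃[ e' ] (E e' × ∃[ θ ] (g ≡ θ ·e e' × GroundEqn g × g ≺e e))

    Redundant : EqnSet → Eqn → Set
    Redundant E e = ∀ σ → GroundEqn (σ ·e e) →
      (σ · lhs e) ≈[ SmallerGroundInstances E (σ ·e e) ] (σ · rhs e)

    FwdStep : EqnSet → EqnSet → EqnSet
    FwdStep R₁ R₂ ρ = ∃[ ρ₁ ] ∃[ ρ₂ ] ∃[ ρ₂' ] (R₁ ρ₁ × R₂ ρ₂ × Variant ρ₂ ρ₂' × Disjoint ρ₁ ρ₂'
      × ∃[ p ] ∃[ u ] (IsFPos (rhs ρ₁) p × subAt (rhs ρ₁) p ≡ just u
      × ∃[ σ ] (IsMGU σ u (lhs ρ₂')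
      × ρ ≡ ((σ · lhs ρ₁) ⇒ (σ · replaceAt (rhs ρ₁) p (rhs ρ₂'))))))

    _⇝_ : EqnSet → EqnSet → EqnSet
    (R₁ ⇝ R₂) ρ = FwdStep R₁ R₂ ρ × ¬ Redundant R₁ ρ

    FC : ℕ → EqnSet → EqnSet
    FC zero R = R
    FC (suc k) R ρ = FC k R ρ ⊎ (FC k R ⇝ R) ρ

    -- FC(R) = R (rules identified up to variable renaming); R ⊆ FC(R) holds by definition
    ForwardClosed : EqnSet → Set
    ForwardClosed R = ∀ k ρ → FC k R ρ → ∃[ ρ' ] (R ρ' × Variant ρ ρ')

    record IsLMSystem (R : EqnSet) : Set where
      field
        isTRS                : IsTRS R
        convergent           : Convergent R
        almostLeftReduced    : AlmostLeftReduced R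
        rightReduced         : RightReduced R
        nonSubtermCollapsing : NonSubtermCollapsing R
        forwardClosed        : ForwardClosed R
        quasiDeterministic   : QuasiDeterministic (RHS R)

-- Let ρ = σ l₁ → σ (r₁[r₂]_p) be a rule of R ⇝ R built from ρ₁ = l₁ → r₁ and ρ₂ = l₂ → r₂.
-- By forward closure a variant of ρ is a rule of R.
-- If p ≠ ε, that rule has the root pair of ρ₁, so quasi-determinism makes ρ an instance
-- of ρ₁; since Var(r₁) ⊆ Var(l₁) this forces σ r₁ = σ (r₁[r₂]_p), a term that rewrites
-- to itself with ρ₂, contradicting termination.
-- If p = ε, the right-hand side of that rule is an instance of r₂, so it forms a
-- right-hand-side critical pair with ρ₂ whose root pair is again that of ρ₁ (because
-- σ r₁ = σ l₂ forces r₁ and l₂ to share their root). Quasi-determinism then makes r₁ an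
-- instance of l₂, contradicting right-reducedness.
module Submission where

open import Defs
open import Data.Nat using (ℕ; suc; _+_; _∸_; _<_; _≤_; _⊔_; _<?_; _≟_)
open import Data.Nat.Properties
  using (n<1+n; <-≤-trans; m≤m⊔n; m≤n⊔m; m≤n+m; m+n≮n; m+n∸n≡m; m∸n+n≡m; ≮⇒≥; <⇒≱)
open import Data.List using ([]; _∷_)
open import Data.Vec using (Vec; []; _∷_; head; tail)
open import Data.Maybe using (just)
open import Data.Product using (∃-syntax; _×_; _,_; proj₁; proj₂)
open import Data.Sum using (inj₁; inj₂)
open import Data.Empty using (⊥; ⊥-elim)
open import Function using (_∘_)
open import Relation.Nullary using (¬_; Dec; yes; no)
open import Relation.Binary.PropositionalEquality
open import Induction.WellFounded using (wf⇒asym)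

module TermProperties (Sig : Signature) where
  open Signature Sig
  open Terms Sig

  infixr 9 _∘s_

  _∘s_ : Subst → Subst → Subst
  (σ ∘s τ) x = σ · τ x

  mutual
    ·-identity : ∀ t → var · t ≡ t
    ·-identity (var x) = refl
    ·-identity (fun f ts) = cong (fun f) (·*-identity ts)

    ·*-identity : ∀ {n} (ts : Vec Term n) → var ·* ts ≡ ts
    ·*-identity [] = refl
    ·*-identity (t ∷ ts) = cong₂ _∷_ (·-identity t) (·*-identity ts)

  mutual
    ·-∘s : ∀ σ τ t → σ · (τ · t) ≡ (σ ∘s τ) · t
    ·-∘s σ τ (var x) = refl
    ·-∘s σ τ (fun f ts) = cong (fun f) (·*-∘s σ τ ts)

    ·*-∘s : ∀ {n} σ τ (ts : Vec Term n) → σ ·* (τ ·* ts) ≡ (σ ∘s τ) ·* ts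
    ·*-∘s σ τ [] = refl
    ·*-∘s σ τ (t ∷ ts) = cong₂ _∷_ (·-∘s σ τ t) (·*-∘s σ τ ts)

  ·e-∘s : ∀ σ τ e → σ ·e (τ ·e e) ≡ (σ ∘s τ) ·e e
  ·e-∘s σ τ (l ⇒ r) = cong₂ _⇒_ (·-∘s σ τ l) (·-∘s σ τ r)

  mutual
    ·-cong-∈V : ∀ σ τ t → (∀ x → x ∈V t → σ x ≡ τ x) → σ · t ≡ τ · t
    ·-cong-∈V σ τ (var x) agree = agree x ([] , refl)
    ·-cong-∈V σ τ (fun f ts) agree =
      cong (fun f) (·*-cong-∈V σ τ ts (λ x i p occ → agree x (i ∷ p , occ)))

    ·*-cong-∈V : ∀ {n} σ τ (ts : Vec Term n) →
                 (∀ x i p → subArgs ts i p ≡ just (var x) → σ x ≡ τ x) → σ ·* ts ≡ τ ·* ts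
    ·*-cong-∈V σ τ [] agree = refl
    ·*-cong-∈V σ τ (t ∷ ts) agree =
      cong₂ _∷_ (·-cong-∈V σ τ t (λ x (p , occ) → agree x 0 p occ))
                (·*-cong-∈V σ τ ts (λ x i p occ → agree x (suc i) p occ))

  fun-injective : ∀ {f} {ts us : Vec Term (arity f)} → fun f ts ≡ fun f us → ts ≡ us
  fun-injective refl = refl

  mutual
    ·-≡⇒agree-∈V : ∀ σ τ t → σ · t ≡ τ · t → ∀ x → x ∈V t → σ x ≡ τ x
    ·-≡⇒agree-∈V σ τ (var y) eq x ([] , refl) = eq
    ·-≡⇒agree-∈V σ τ (fun f ts) eq x (i ∷ p , occ) =
      ·*-≡⇒agree-∈V σ τ ts (fun-injective eq) x i p occ

    ·*-≡⇒agree-∈V : ∀ {n} σ τ (ts : Vec Term n) → σ ·* ts ≡ τ ·* ts →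
                    ∀ x i p → subArgs ts i p ≡ just (var x) → σ x ≡ τ x
    ·*-≡⇒agree-∈V σ τ (t ∷ ts) eq x 0 p occ = ·-≡⇒agree-∈V σ τ t (cong head eq) x (p , occ)
    ·*-≡⇒agree-∈V σ τ (t ∷ ts) eq x (suc i) p occ = ·*-≡⇒agree-∈V σ τ ts (cong tail eq) x i p occ

  mutual
    subAt-· : ∀ σ t p {u} → subAt t p ≡ just u → subAt (σ · t) p ≡ just (σ · u)
    subAt-· σ t [] refl = refl
    subAt-· σ (fun f ts) (i ∷ p) at = subArgs-· σ ts i p at

    subArgs-· : ∀ {n} σ (ts : Vec Term n) i p {u} → subArgs ts i p ≡ just u →
                subArgs (σ ·* ts) i p ≡ just (σ · u)
    subArgs-· σ (t ∷ ts) 0 p at = subAt-· σ t p at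
    subArgs-· σ (t ∷ ts) (suc i) p at = subArgs-· σ ts i p at

  mutual
    replaceAt-· : ∀ σ t p {u} v → subAt t p ≡ just u →
                  σ · replaceAt t p v ≡ replaceAt (σ · t) p (σ · v)
    replaceAt-· σ t [] v at = refl
    replaceAt-· σ (fun f ts) (i ∷ p) v at = cong (fun f) (replaceArgs-· σ ts i p v at)

    replaceArgs-· : ∀ {n} σ (ts : Vec Term n) i p {u} v → subArgs ts i p ≡ just u →
                    σ ·* replaceArgs ts i p v ≡ replaceArgs (σ ·* ts) i p (σ · v)
    replaceArgs-· σ (t ∷ ts) 0 p v at = cong (_∷ σ ·* ts) (replaceAt-· σ t p v at)
    replaceArgs-· σ (t ∷ ts) (suc i) p v at = cong (σ · t ∷_) (replaceArgs-· σ ts i p v at)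

  mutual
    _∈V?_ : ∀ x t → Dec (x ∈V t)
    x ∈V? var y with x ≟ y
    ... | yes refl = yes ([] , refl)
    ... | no x≢y = no λ { ([] , refl) → x≢y refl }
    x ∈V? fun f ts with x ∈Args? ts
    ... | yes (i , p , occ) = yes (i ∷ p , occ)
    ... | no ∉ts = no λ { (i ∷ p , occ) → ∉ts (i , p , occ) }

    _∈Args?_ : ∀ {n} x (ts : Vec Term n) → Dec (∃[ i ] ∃[ p ] (subArgs ts i p ≡ just (var x)))
    x ∈Args? [] = no λ ()
    x ∈Args? (t ∷ ts) with x ∈V? t | x ∈Args? ts
    ... | yes (p , occ) | _ = yes (0 , p , occ)
    ... | no _ | yes (i , p , occ) = yes (suc i , p , occ)
    ... | no ∉t | no ∉ts =
      no λ { (0 , p , occ) → ∉t (p , occ) ; (suc i , p , occ) → ∉ts (i , p , occ) }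

  mutual
    varBound : Term → ℕ
    varBound (var x) = suc x
    varBound (fun f ts) = varBoundArgs ts

    varBoundArgs : ∀ {n} → Vec Term n → ℕ
    varBoundArgs [] = 0
    varBoundArgs (t ∷ ts) = varBound t ⊔ varBoundArgs ts

  mutual
    ∈V⇒<varBound : ∀ t {x} → x ∈V t → x < varBound t
    ∈V⇒<varBound (var x) ([] , refl) = n<1+n x
    ∈V⇒<varBound (fun f ts) (i ∷ p , occ) = ∈Args⇒<varBoundArgs ts i p occ

    ∈Args⇒<varBoundArgs : ∀ {n} (ts : Vec Term n) {x} i p →
                          subArgs ts i p ≡ just (var x) → x < varBoundArgs ts
    ∈Args⇒<varBoundArgs (t ∷ ts) 0 p occ =
      <-≤-trans (∈V⇒<varBound t (p , occ)) (m≤m⊔n (varBound t) (varBoundArgs ts))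
    ∈Args⇒<varBoundArgs (t ∷ ts) (suc i) p occ =
      <-≤-trans (∈Args⇒<varBoundArgs ts i p occ) (m≤n⊔m (varBound t) (varBoundArgs ts))

  eqnVarBound : Eqn → ℕ
  eqnVarBound e = varBound (lhs e) ⊔ varBound (rhs e)

  ∈Ve⇒<eqnVarBound : ∀ e {x} → x ∈Ve e → x < eqnVarBound e
  ∈Ve⇒<eqnVarBound e (inj₁ occ) = <-≤-trans (∈V⇒<varBound (lhs e) occ) (m≤m⊔n _ _)
  ∈Ve⇒<eqnVarBound e (inj₂ occ) = <-≤-trans (∈V⇒<varBound (rhs e) occ) (m≤n⊔m _ _)

  mutual
    ∈V-· : ∀ σ t {x} → x ∈V (σ · t) → ∃[ y ] (y ∈V t × x ∈V σ y)
    ∈V-· σ (var y) occ = y , ([] , refl) , occ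
    ∈V-· σ (fun f ts) (i ∷ p , occ) with ∈Args-· σ ts i p occ
    ... | y , (j , q , occ′) , inσy = y , (j ∷ q , occ′) , inσy

    ∈Args-· : ∀ {n} σ (ts : Vec Term n) {x} i p → subArgs (σ ·* ts) i p ≡ just (var x) →
              ∃[ y ] ((∃[ j ] ∃[ q ] (subArgs ts j q ≡ just (var y))) × x ∈V σ y)
    ∈Args-· σ (t ∷ ts) 0 p occ with ∈V-· σ t (p , occ)
    ... | y , (q , occ′) , inσy = y , (0 , q , occ′) , inσy
    ∈Args-· σ (t ∷ ts) (suc i) p occ with ∈Args-· σ ts i p occ
    ... | y , (j , q , occ′) , inσy = y , (suc j , q , occ′) , inσy

  ·-agree-lhs⇒·-agree-rhs : ∀ σ τ l r → (∀ x → x ∈V r → x ∈V l) →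
                            σ · l ≡ τ · l → σ · r ≡ τ · r
  ·-agree-lhs⇒·-agree-rhs σ τ l r r⊆l eq =
    ·-cong-∈V σ τ r (λ x occ → ·-≡⇒agree-∈V σ τ l eq x (r⊆l x occ))

  RootPair : Eqn → Fun → Fun → Set
  RootPair e f g = HasRoot (lhs e) f × HasRoot (rhs e) g

  HasRoot-· : ∀ σ {t f} → HasRoot t f → HasRoot (σ · t) f
  HasRoot-· σ (ts , refl) = σ ·* ts , refl

  HasRoot-replaceAt : ∀ {t f} i p v → HasRoot t f → HasRoot (replaceAt t (i ∷ p) v) f
  HasRoot-replaceAt i p v (ts , refl) = replaceArgs ts i p v , refl

  HasRoot-functional : ∀ {t f g} → HasRoot t f → HasRoot t g → f ≡ g
  HasRoot-functional (ts , refl) (us , refl) = refl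

  ¬IsVar⇒HasRoot : ∀ t → ¬ IsVar t → ∃[ f ] HasRoot t f
  ¬IsVar⇒HasRoot (var x) ¬var = ⊥-elim (¬var (x , refl))
  ¬IsVar⇒HasRoot (fun f ts) ¬var = f , ts , refl

  Step-root : ∀ {R ρ t} σ → R ρ → t ≡ σ · lhs ρ → Step R t (σ · rhs ρ)
  Step-root σ ρ∈R t≡σl = _ , ρ∈R , σ , [] , cong just t≡σl , refl

  ⇝-reduct : ∀ {R ρ u} σ α r p → R ρ → subAt r p ≡ just u → σ · u ≡ σ · (α · lhs ρ) →
             Step R (σ · r) (σ · replaceAt r p (α · rhs ρ))
  ⇝-reduct {ρ = ρ} σ α r p ρ∈R at unifies =
    ρ , ρ∈R , σ ∘s α , p ,
    trans (subAt-· σ r p at) (cong just (trans unifies (·-∘s σ α (lhs ρ)))) ,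
    trans (replaceAt-· σ r p (α · rhs ρ) at) (cong (replaceAt (σ · r) p) (·-∘s σ α (rhs ρ)))

  shift : ℕ → Subst
  shift N x = var (x + N)

  shift-variant : ∀ N e → Variant e (shift N ·e e)
  shift-variant N (l ⇒ r) =
    (shift N , refl) , (unshift , cong₂ _⇒_ (unshift-shift l) (unshift-shift r))
    where
    unshift : Subst
    unshift x = var (x ∸ N)

    unshift-shift : ∀ t → unshift · (shift N · t) ≡ t
    unshift-shift t = begin
      unshift · (shift N · t)   ≡⟨ ·-∘s unshift (shift N) t ⟩
      (unshift ∘s shift N) · t  ≡⟨ ·-cong-∈V _ var t (λ x _ → cong var (m+n∸n≡m x N)) ⟩
      var · t                   ≡⟨ ·-identity t ⟩
      t                         ∎
      where open ≡-Reasoning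

  ∈V-shift⇒≥ : ∀ N t {x} → x ∈V (shift N · t) → N ≤ x
  ∈V-shift⇒≥ N t occ with ∈V-· (shift N) t occ
  ... | y , _ , ([] , refl) = m≤n+m N y

  shift-disjoint : ∀ e e′ → Disjoint e (shift (eqnVarBound e) ·e e′)
  shift-disjoint e e′ x x∈e x∈e′ = <⇒≱ (∈Ve⇒<eqnVarBound e x∈e) (above x∈e′)
    where
    above : x ∈Ve (shift (eqnVarBound e) ·e e′) → eqnVarBound e ≤ x
    above (inj₁ occ) = ∈V-shift⇒≥ _ (lhs e′) occ
    above (inj₂ occ) = ∈V-shift⇒≥ _ (rhs e′) occ

  -- σ consults ζ only on (shifted) variables of r: elsewhere ζ is not determined by a
  -- unifier, and using it there would break generality.
  instance-mgu : ∀ N t r ζ → (∀ x → x ∈V t → x < N) → t ≡ ζ · r →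
                 ∃[ σ ] IsMGU σ t (shift N · r)
  instance-mgu N t r ζ t<N t≡ζr = σ , unifies , (λ θ θunifies → θ , general θ θunifies)
    where
    σ : Subst
    σ x with x <? N | (x ∸ N) ∈V? r
    ... | yes _ | _ = var x
    ... | no _ | yes _ = ζ (x ∸ N)
    ... | no _ | no _ = var x

    σ-fixes-t : σ · t ≡ t
    σ-fixes-t = trans (·-cong-∈V σ var t fixes) (·-identity t)
      where
      fixes : ∀ x → x ∈V t → σ x ≡ var x
      fixes x occ with x <? N
      ... | yes _ = refl
      ... | no x≮N = ⊥-elim (x≮N (t<N x occ))

    σ∘shift-agrees-ζ : ∀ y → y ∈V r → (σ ∘s shift N) y ≡ ζ y
    σ∘shift-agrees-ζ y occ with (y + N) <? N | (y + N ∸ N) ∈V? r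
    ... | yes y+N<N | _ = ⊥-elim (m+n≮n y N y+N<N)
    ... | no _ | yes _ = cong ζ (m+n∸n≡m y N)
    ... | no _ | no ∉r = ⊥-elim (∉r (subst (_∈V r) (sym (m+n∸n≡m y N)) occ))

    unifies : σ · t ≡ σ · (shift N · r)
    unifies = begin
      σ · t                     ≡⟨ σ-fixes-t ⟩
      t                         ≡⟨ t≡ζr ⟩
      ζ · r                     ≡⟨ ·-cong-∈V ζ (σ ∘s shift N) r (λ y → sym ∘ σ∘shift-agrees-ζ y) ⟩
      (σ ∘s shift N) · r        ≡⟨ ·-∘s σ (shift N) r ⟨
      σ · (shift N · r)         ∎
      where open ≡-Reasoning

    general : ∀ θ → θ · t ≡ θ · (shift N · r) → ∀ x → θ x ≡ θ · σ x
    general θ θunifies x with x <? N | (x ∸ N) ∈V? r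
    ... | yes _ | _ = refl
    ... | no _ | no _ = refl
    ... | no x≮N | yes occ = begin
      θ x                       ≡⟨ cong θ (m∸n+n≡m (≮⇒≥ x≮N)) ⟨
      (θ ∘s shift N) (x ∸ N)    ≡⟨ ·-≡⇒agree-∈V (θ ∘s ζ) (θ ∘s shift N) r θζr≡θshiftr (x ∸ N) occ ⟨
      θ · ζ (x ∸ N)             ∎
      where
      open ≡-Reasoning
      θζr≡θshiftr : (θ ∘s ζ) · r ≡ (θ ∘s shift N) · r
      θζr≡θshiftr = begin
        (θ ∘s ζ) · r            ≡⟨ ·-∘s θ ζ r ⟨
        θ · (ζ · r)             ≡⟨ cong (θ ·_) t≡ζr ⟨
        θ · t                   ≡⟨ θunifies ⟩
        θ · (shift N · r)       ≡⟨ ·-∘s θ (shift N) r ⟩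
        (θ ∘s shift N) · r      ∎

  RHSCP-of-rhs-instance : ∀ {R ρ₁ ρ₂ f g} ζ → R ρ₁ → R ρ₂ → rhs ρ₁ ≡ ζ · rhs ρ₂ →
                          HasRoot (lhs ρ₁) f → HasRoot (lhs ρ₂) g → f ≢ g →
                          ∃[ σ ] ∃[ ξ ] RHSCP R ((σ · lhs ρ₁) ⇒ (ξ · lhs ρ₂))
  RHSCP-of-rhs-instance {ρ₁ = ρ₁} {ρ₂} {f} ζ ρ₁∈R ρ₂∈R r₁≡ζr₂ l₁f l₂g f≢g =
    σ , σ ∘s shift N , ρ₁ , ρ₂ , shift N ·e ρ₂ , ρ₁∈R , ρ₂∈R ,
    shift-variant N ρ₂ , shift-disjoint ρ₁ ρ₂ , σ , unifier .proj₂ , lhss-differ ,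
    cong ((σ · lhs ρ₁) ⇒_) (sym (·-∘s σ (shift N) (lhs ρ₂)))
    where
    N : ℕ
    N = eqnVarBound ρ₁

    unifier : ∃[ σ ] IsMGU σ (rhs ρ₁) (shift N · rhs ρ₂)
    unifier = instance-mgu N (rhs ρ₁) (rhs ρ₂) ζ (λ x occ → ∈Ve⇒<eqnVarBound ρ₁ (inj₂ occ)) r₁≡ζr₂

    σ : Subst
    σ = unifier .proj₁

    lhss-differ : σ · lhs ρ₁ ≢ σ · (shift N · lhs ρ₂)
    lhss-differ eq = f≢g (HasRoot-functional (subst (λ t → HasRoot t f) eq (HasRoot-· σ l₁f))
                                             (HasRoot-· σ (HasRoot-· (shift N) l₂g)))

module LMSystem {Sig : Signature} (_≺_ : Terms.Term Sig → Terms.Term Sig → Set)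
                {R : Terms.EqnSet Sig} (lm : Terms.Order.IsLMSystem Sig _≺_ R) where
  open Signature Sig
  open Terms Sig
  open Terms.Order Sig _≺_
  open IsLMSystem lm
  open TermProperties Sig

  rootPair : ∀ {ρ} → R ρ → ∃[ f ] ∃[ g ] (RootPair ρ f g × f ≢ g)
  rootPair {ρ} ρ∈R with quasiDeterministic .proj₁ ρ (inj₁ ρ∈R)
  ... | ¬varˡ , ¬varʳ with ¬IsVar⇒HasRoot (lhs ρ) ¬varˡ | ¬IsVar⇒HasRoot (rhs ρ) ¬varʳ
  ... | f , lf | g , rg =
    f , g , (lf , rg) , quasiDeterministic .proj₂ .proj₁ ρ (inj₁ ρ∈R) f g lf rg

  RootPair⇒Variant : ∀ {e e′ f g} → RHS R e → RHS R e′ → RootPair e f g → RootPair e′ f g →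
                     Variant e e′
  RootPair⇒Variant e∈ e′∈ (lf , rg) (lf′ , rg′) =
    quasiDeterministic .proj₂ .proj₂ _ _ e∈ e′∈ _ _ lf rg lf′ rg′

  ¬Step-refl : ∀ {t} → ¬ Step R t t
  ¬Step-refl step = wf⇒asym (convergent .proj₂) step step

  instance-rhs-determined-by-lhs : ∀ {ρ σ τ s} → R ρ → τ ·e ρ ≡ ((σ · lhs ρ) ⇒ s) → σ · rhs ρ ≡ s
  instance-rhs-determined-by-lhs {ρ} {σ} {τ} ρ∈R eq =
    trans (·-agree-lhs⇒·-agree-rhs σ τ (lhs ρ) (rhs ρ) (isTRS ρ ρ∈R) (sym (cong lhs eq)))
          (cong rhs eq)

  ⇝-below-root-⊥ : ∀ {ρ₁ ρ₂ ρ′ σ α i p u} → R ρ₁ → R ρ₂ → R ρ′ →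
                   subAt (rhs ρ₁) (i ∷ p) ≡ just u → σ · u ≡ σ · (α · lhs ρ₂) →
                   Variant ((σ · lhs ρ₁) ⇒ (σ · replaceAt (rhs ρ₁) (i ∷ p) (α · rhs ρ₂))) ρ′ → ⊥
  ⇝-below-root-⊥ {ρ₁} {ρ₂} {ρ′} {σ} {α} {i} {p} ρ₁∈R ρ₂∈R ρ′∈R at unifies ((μ , μeq) , (ν , νeq))
    with rootPair ρ₁∈R
  ... | f , g , (lf , rg) , _ = ¬Step-refl (subst (Step R (σ · rhs ρ₁)) (sym σr₁-fixed) reduct)
    where
    ρ : Eqn
    ρ = (σ · lhs ρ₁) ⇒ (σ · replaceAt (rhs ρ₁) (i ∷ p) (α · rhs ρ₂))

    ρ′-rootPair : RootPair ρ′ f g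
    ρ′-rootPair = subst (λ e → RootPair e f g) μeq
      (HasRoot-· μ (HasRoot-· σ lf) , HasRoot-· μ (HasRoot-· σ (HasRoot-replaceAt i p _ rg)))

    ρ-instance : ∃[ τ ] (τ ·e ρ₁ ≡ ρ)
    ρ-instance with RootPair⇒Variant (inj₁ ρ₁∈R) (inj₁ ρ′∈R) (lf , rg) ρ′-rootPair
    ... | (κ , κeq) , _ = ν ∘s κ , trans (sym (·e-∘s ν κ ρ₁)) (trans (cong (ν ·e_) κeq) νeq)

    σr₁-fixed : σ · rhs ρ₁ ≡ σ · replaceAt (rhs ρ₁) (i ∷ p) (α · rhs ρ₂)
    σr₁-fixed = instance-rhs-determined-by-lhs ρ₁∈R (ρ-instance .proj₂)

    reduct : Step R (σ · rhs ρ₁) (σ · replaceAt (rhs ρ₁) (i ∷ p) (α · rhs ρ₂))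
    reduct = ⇝-reduct σ α (rhs ρ₁) (i ∷ p) ρ₂∈R at unifies

  ⇝-at-root-⊥ : ∀ {ρ₁ ρ₂ ρ′ σ α} → R ρ₁ → R ρ₂ → R ρ′ → σ · rhs ρ₁ ≡ σ · (α · lhs ρ₂) →
                Variant ((σ · lhs ρ₁) ⇒ (σ · (α · rhs ρ₂))) ρ′ → ⊥
  ⇝-at-root-⊥ {ρ₁} {ρ₂} {ρ′} {σ} {α} ρ₁∈R ρ₂∈R ρ′∈R unifies ((μ , μeq) , _)
    with rootPair ρ₁∈R | rootPair ρ₂∈R
  ... | f , g , (lf , rg) , f≢g | h , _ , (l₂h , _) , _ =
    rightReduced ρ₁ ρ₁∈R _ (Step-root (κ ∘s ξ) ρ₂∈R r₁-instance-of-l₂)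
    where
    g≡h : g ≡ h
    g≡h = HasRoot-functional (subst (λ t → HasRoot t g) unifies (HasRoot-· σ rg))
                             (HasRoot-· σ (HasRoot-· α l₂h))

    ζ : Subst
    ζ = (μ ∘s σ) ∘s α

    r′≡ζr₂ : rhs ρ′ ≡ ζ · rhs ρ₂
    r′≡ζr₂ = begin
      rhs ρ′                    ≡⟨ cong rhs μeq ⟨
      μ · (σ · (α · rhs ρ₂))    ≡⟨ ·-∘s μ σ (α · rhs ρ₂) ⟩
      (μ ∘s σ) · (α · rhs ρ₂)   ≡⟨ ·-∘s (μ ∘s σ) α (rhs ρ₂) ⟩
      ζ · rhs ρ₂                ∎
      where open ≡-Reasoning

    l′f : HasRoot (lhs ρ′) f
    l′f = subst (λ t → HasRoot t f) (cong lhs μeq) (HasRoot-· μ (HasRoot-· σ lf))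

    criticalPair : ∃[ σ′ ] ∃[ ξ ] RHSCP R ((σ′ · lhs ρ′) ⇒ (ξ · lhs ρ₂))
    criticalPair = RHSCP-of-rhs-instance ζ ρ′∈R ρ₂∈R r′≡ζr₂ l′f l₂h
                     (f≢g ∘ λ f≡h → trans f≡h (sym g≡h))

    σ′ ξ : Subst
    σ′ = criticalPair .proj₁
    ξ = criticalPair .proj₂ .proj₁

    ρ₁-instance : ∃[ κ ] (κ ·e ((σ′ · lhs ρ′) ⇒ (ξ · lhs ρ₂)) ≡ ρ₁)
    ρ₁-instance = RootPair⇒Variant (inj₂ (criticalPair .proj₂ .proj₂)) (inj₁ ρ₁∈R)
      (HasRoot-· σ′ l′f , subst (HasRoot _) (sym g≡h) (HasRoot-· ξ l₂h)) (lf , rg) .proj₁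

    κ : Subst
    κ = ρ₁-instance .proj₁

    r₁-instance-of-l₂ : rhs ρ₁ ≡ (κ ∘s ξ) · lhs ρ₂
    r₁-instance-of-l₂ = trans (sym (cong rhs (ρ₁-instance .proj₂))) (·-∘s κ ξ (lhs ρ₂))

  FwdStep⇒¬variant∈R : ∀ {ρ} → FwdStep R R ρ → ¬ (∃[ ρ′ ] (R ρ′ × Variant ρ ρ′))
  FwdStep⇒¬variant∈R
    (_ , _ , _ , ρ₁∈R , ρ₂∈R , ((α , refl) , _) , _ , [] , _ , _ , refl , σ , (unifies , _) , refl)
    (_ , ρ′∈R , variant) = ⇝-at-root-⊥ ρ₁∈R ρ₂∈R ρ′∈R unifies variant
  FwdStep⇒¬variant∈R
    (_ , _ , _ , ρ₁∈R , ρ₂∈R , ((α , refl) , _) , _ , i ∷ p , _ , _ , at , σ , (unifies , _) , refl)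
    (_ , ρ′∈R , variant) = ⇝-below-root-⊥ ρ₁∈R ρ₂∈R ρ′∈R at unifies variant

  R⇝R-empty : ∀ ρ → ¬ (R ⇝ R) ρ
  R⇝R-empty ρ ρ∈R⇝R@(fwdStep , _) = FwdStep⇒¬variant∈R fwdStep (forwardClosed 1 ρ (inj₂ ρ∈R⇝R))

lemma7 : (Sig : Signature) (_≺_ : Terms.Term Sig → Terms.Term Sig → Set) →
         Terms.IsReductionOrder Sig _≺_ →
         (R : Terms.EqnSet Sig) → Terms.Order.IsLMSystem Sig _≺_ R →
         ∀ ρ → ¬ (Terms.Order._⇝_ Sig _≺_ R R ρ)
lemma7 Sig _≺_ _ R lm = LMSystem.R⇝R-empty _≺_ lm
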